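{- Let $\mathcal{V}=\{V_1,\ldots,V_N\}$ be a finite set of views over a vocabulary $\sigma$, and let $\mathbf{I},\mathbf{J}$ be $\sigma$-structures such that for every $i\in\{0,\ldots,2^N-1\}$, $C_i(\mathbf{I})\neq\emptyset$ if and only if $C_i(\mathbf{J})\neq\emptyset$. Then for every sentence $\phi\in\mathrm{UCV}(\sigma,\mathcal{V})$, $\mathbf{I}\models\phi$ iff $\mathbf{J}\models\phi$.
   Context: A view over $\sigma$ is a unary conjunctive query without equality and without negation: a formula $V(y)\equiv\exists x_1,\ldots,x_n\,(R_1(u_1)\wedge\cdots\wedge R_k(u_k))$ with exactly one free variable $y$, $R_i\in\sigma$, $u_i$ tuples of variables. $\mathrm{UCV}(\sigma,\mathcal{V})$ is the smallest set of formulas containing $V(x)$ for each $V\in\mathcal{V}$ and each variable $x$, closed under $\neg$, $\wedge$, $\exists x$, interpreted over $\sigma$-structures by expanding view definitions. For $0\le i\le 2^N-1$, $C_i(x)$ is the formula $(\neg)V_1(x)\wedge\cdots\wedge(\neg)V_N(x)$ in which the conjunct $V_j(x)$ is negated iff the $j$-th bit of the binary representation of $i$ is $0$; $C_i(\mathbf{A})$ denotes the set of elements of $\mathbf{A}$ satisfying $C_i$. -}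

module Defs where

open import Data.Nat using (ℕ; zero; suc; _%_; _/_; _≡ᵇ_)
open import Data.Fin using (Fin; toℕ)
open import Data.Bool using (Bool; true; false; if_then_else_)
open import Data.Vec using (Vec)
import Data.Vec as Vec
open import Data.List using (List; []; _∷_)
open import Data.List.Relation.Unary.All using (All)
open import Data.List.Relation.Unary.Any using (Any)
import Data.Vec.Membership.Propositional as VecMem
open import Data.List.Membership.Propositional using (_∈_)
open import Data.Product using (Σ; _×_; _,_; proj₁; proj₂)
open import Data.Maybe using (Maybe; just; nothing)
open import Data.Empty using (⊥)
open import Relation.Nullary using (¬_)
open import Relation.Binary.PropositionalEquality using (_≡_)

record Vocabulary : Set where
  field
    nsyms : ℕ
    arity : Fin nsyms → ℕ
open Vocabulary public

record Structure (σ : Vocabulary) : Set where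
  field
    size : ℕ
    rel  : (R : Fin (nsyms σ)) → Vec (Fin size) (arity σ R) → Bool
open Structure public

Dom : {σ : Vocabulary} → Structure σ → Set
Dom A = Fin (size A)

-- Views: unary conjunctive queries without equality / negation
--   V(y) ≡ ∃ x₁ … xₙ (R₁(u₁) ∧ … ∧ R_k(u_k)).
-- Variables are Fin (suc nvars): `zero` is the free variable y,
-- `suc i` is the bound variable x_{i+1}.

Atom : Vocabulary → ℕ → Set
Atom σ n = Σ (Fin (nsyms σ)) λ R → Vec (Fin (suc n)) (arity σ R)

record View (σ : Vocabulary) : Set where
  field
    nvars : ℕ
    atoms : List (Atom σ nvars)
    free-occurs : Any (λ at → VecMem._∈_ Fin.zero (proj₂ at)) atoms
open View public

AtomHolds : {σ : Vocabulary} (A : Structure σ) {n : ℕ} →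
            (Fin (suc n) → Dom A) → Atom σ n → Set
AtomHolds A g (R , u) = rel A R (Vec.map g u) ≡ true

ViewHolds : {σ : Vocabulary} (A : Structure σ) → View σ → Dom A → Set
ViewHolds A V a =
  Σ (Fin (suc (nvars V)) → Dom A) λ g →
    (g Fin.zero ≡ a) × All (AtomHolds A g) (atoms V)

data UCV (N : ℕ) : Set where
  view : Fin N → ℕ → UCV N
  ¬'   : UCV N → UCV N
  _∧'_ : UCV N → UCV N → UCV N
  ∃'   : ℕ → UCV N → UCV N

Scoped : {N : ℕ} → List ℕ → UCV N → Set
Scoped bs (view j x) = x ∈ bs
Scoped bs (¬' φ)     = Scoped bs φ
Scoped bs (φ ∧' ψ)   = Scoped bs φ × Scoped bs ψ
Scoped bs (∃' x φ)   = Scoped (x ∷ bs) φ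

Sentence : {N : ℕ} → UCV N → Set
Sentence φ = Scoped [] φ

Env : {σ : Vocabulary} → Structure σ → Set
Env A = ℕ → Maybe (Dom A)

update : {σ : Vocabulary} {A : Structure σ} → Env A → ℕ → Dom A → Env A
update e x a y = if x Data.Nat.≡ᵇ y then just a else e y

Sat : {σ : Vocabulary} {N : ℕ} (A : Structure σ) (𝒱 : Fin N → View σ) →
      Env A → UCV N → Set
Sat A 𝒱 e (view j x) with e x
... | just a  = ViewHolds A (𝒱 j) a
... | nothing = ⊥
Sat A 𝒱 e (¬' φ)   = ¬ Sat A 𝒱 e φ
Sat A 𝒱 e (φ ∧' ψ) = Sat A 𝒱 e φ × Sat A 𝒱 e ψ
Sat A 𝒱 e (∃' x φ) = Σ (Dom A) λ a → Sat A 𝒱 (update {A = A} e x a) φ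

_,_⊨_ : {σ : Vocabulary} {N : ℕ} (A : Structure σ) (𝒱 : Fin N → View σ) →
        UCV N → Set
A , 𝒱 ⊨ φ = Sat A 𝒱 (λ _ → nothing) φ

bit : ℕ → ℕ → Bool
bit i zero    = i % 2 ≡ᵇ 1
bit i (suc j) = bit (i / 2) j

-- a ∈ C_i(A): V_j(a) holds iff bit j of i is 1, negated iff it is 0
-- (j : Fin N, the view 𝒱 j is V_{j+1} and uses bit position toℕ j)
InC : {σ : Vocabulary} {N : ℕ} (A : Structure σ) (𝒱 : Fin N → View σ) →
      ℕ → Dom A → Set
InC {N = N} A 𝒱 i a = (j : Fin N) →
  if bit i (toℕ j) then ViewHolds A (𝒱 j) a else ¬ ViewHolds A (𝒱 j) a

CNonEmpty : {σ : Vocabulary} {N : ℕ} (A : Structure σ) (𝒱 : Fin N → View σ) →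
            ℕ → Set
CNonEmpty A 𝒱 i = Σ (Dom A) λ a → InC A 𝒱 i a

-- Call a and b view-equivalent if they satisfy the same views. Since view
-- satisfaction is decidable on finite structures, every element a lies in the
-- class C_i whose index i lists in binary the views holding at a, and two
-- elements of the same class are view-equivalent. So the hypothesis makes
-- view-equivalence total in both directions between I and J; as a view atom
-- sees only the view type of its argument, such a relation is a back-and-forth
-- system, and pointwise related environments satisfy the same UCV formulas.
module Submission where

open import Defs
open import Data.Nat using (ℕ; zero; suc; _+_; _*_; _%_; _/_; _<_; _≤_; _^_; _≡ᵇ_; s≤s; z≤n)
open import Data.Nat.Properties using (*-comm; *-monoˡ-≤; +-monoˡ-≤)
open import Data.Nat.DivMod using ([m+kn]%n≡m%n; +-distrib-/; m*n%n≡0; m*n/n≡m)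
open import Data.Fin using (Fin; toℕ)
import Data.Fin as Fin
open import Data.Fin.Properties using (any?; _≟_)
open import Data.Bool using (Bool; true; false)
import Data.Bool.Properties as Bool
import Data.Vec as Vec
open import Data.Vec.Properties using (map-cong)
open import Data.Vec.Functional using (Vector; head; tail) renaming (_∷_ to _∷ᶠ_)
open import Data.List.Relation.Unary.All as All using (All)
open import Data.Product using (∃; _×_; _,_)
open import Data.Maybe using (just; nothing)
open import Data.Maybe.Relation.Binary.Pointwise using (Pointwise; just; nothing)
open import Data.Empty using (⊥-elim)
open import Relation.Nullary using (Dec; yes; no)
open import Relation.Nullary.Decidable using (isYes; _×-dec_)
open import Relation.Binary.PropositionalEquality using (_≡_; refl; sym; trans; cong; subst; _≗_)
open import Function using (_∘′_)
open import Function.Bundles using (_⇔_; mk⇔; Equivalence)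
open import Function.Related.TypeIsomorphisms using (¬-cong-⇔)
open import Data.Product.Function.NonDependent.Propositional using (_×-⇔_)
import Function.Properties.Equivalence as ⇔

fromBool : Bool → ℕ
fromBool false = 0
fromBool true  = 1

fromBits : {N : ℕ} → (Fin N → Bool) → ℕ
fromBits {zero}  f = 0
fromBits {suc N} f = fromBool (head f) + fromBits (tail f) * 2

fromBool-%2 : ∀ b → (fromBool b % 2 ≡ᵇ 1) ≡ b
fromBool-%2 false = refl
fromBool-%2 true  = refl

fromBool+k*2/2≡k : ∀ b k → (fromBool b + k * 2) / 2 ≡ k
fromBool+k*2/2≡k false k = m*n/n≡m k 2
fromBool+k*2/2≡k true  k = trans (+-distrib-/ 1 (k * 2) no-carry) (m*n/n≡m k 2)
  where
  no-carry : 1 % 2 + (k * 2) % 2 < 2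
  no-carry = subst (λ r → 1 % 2 + r < 2) (sym (m*n%n≡0 k 2)) (s≤s (s≤s z≤n))

bit-fromBits : {N : ℕ} (f : Fin N → Bool) (j : Fin N) → bit (fromBits f) (toℕ j) ≡ f j
bit-fromBits {suc N} f Fin.zero =
  trans (cong (_≡ᵇ 1) ([m+kn]%n≡m%n (fromBool (head f)) (fromBits (tail f)) 2))
        (fromBool-%2 (head f))
bit-fromBits {suc N} f (Fin.suc j) =
  trans (cong (λ i → bit i (toℕ j)) (fromBool+k*2/2≡k (head f) (fromBits (tail f))))
        (bit-fromBits (tail f) j)

fromBool≤1 : ∀ b → fromBool b ≤ 1
fromBool≤1 false = z≤n
fromBool≤1 true  = s≤s z≤n

fromBits<2^N : {N : ℕ} (f : Fin N → Bool) → fromBits f < 2 ^ N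
fromBits<2^N {zero}  f = s≤s z≤n
fromBits<2^N {suc N} f = begin-strict
  fromBool (head f) + k * 2 <⟨ s≤s (+-monoˡ-≤ (k * 2) (fromBool≤1 (head f))) ⟩
  suc k * 2                 ≤⟨ *-monoˡ-≤ 2 (fromBits<2^N (tail f)) ⟩
  2 ^ N * 2                 ≡⟨ *-comm (2 ^ N) 2 ⟩
  2 ^ suc N                 ∎
  where
  open Data.Nat.Properties.≤-Reasoning
  k = fromBits (tail f)

∷-cong : {A : Set} {n : ℕ} (x : A) {g h : Vector A n} → g ≗ h → (x ∷ᶠ g) ≗ (x ∷ᶠ h)
∷-cong x g≗h Fin.zero    = refl
∷-cong x g≗h (Fin.suc i) = g≗h i

head∷tail : {A : Set} {n : ℕ} (g : Vector A (suc n)) → g ≗ (head g ∷ᶠ tail g)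
head∷tail g Fin.zero    = refl
head∷tail g (Fin.suc i) = refl

∃-vector? : {k n : ℕ} {P : Vector (Fin k) n → Set} →
            (∀ {g h} → g ≗ h → P g → P h) → (∀ g → Dec (P g)) → Dec (∃ P)
∃-vector? {n = zero} resp P? with P? (λ ())
... | yes p = yes (_ , p)
... | no ¬p = no λ (g , p) → ¬p (resp (λ ()) p)
∃-vector? {n = suc n} resp P?
  with any? (λ x → ∃-vector? (λ g≗h → resp (∷-cong x g≗h)) (λ g → P? (x ∷ᶠ g)))
... | yes (x , g , p) = yes (x ∷ᶠ g , p)
... | no ¬q = no λ (g , p) → ¬q (head g , tail g , resp (head∷tail g) p)

module _ {σ : Vocabulary} (A : Structure σ) (V : View σ) (a : Dom A) where

  private
    Witness : (Fin (suc (nvars V)) → Dom A) → Set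
    Witness g = (g Fin.zero ≡ a) × All (AtomHolds A g) (atoms V)

    Witness-resp : ∀ {g h} → g ≗ h → Witness g → Witness h
    Witness-resp g≗h (g0≡a , holds) =
      trans (sym (g≗h Fin.zero)) g0≡a ,
      All.map (λ {(R , u)} → trans (cong (rel A R) (sym (map-cong g≗h u)))) holds

    Witness? : ∀ g → Dec (Witness g)
    Witness? g = (g Fin.zero ≟ a) ×-dec
                 All.all? (λ (R , u) → rel A R (Vec.map g u) Bool.≟ true) (atoms V)

  ViewHolds? : Dec (ViewHolds A V a)
  ViewHolds? = ∃-vector? Witness-resp Witness?

module _ {σ : Vocabulary} {N : ℕ} (𝒱 : Fin N → View σ) where

  ViewEquivalent : (A B : Structure σ) → Dom A → Dom B → Set
  ViewEquivalent A B a b = (j : Fin N) → ViewHolds A (𝒱 j) a ⇔ ViewHolds B (𝒱 j) b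

  viewType : (A : Structure σ) → Dom A → Fin N → Bool
  viewType A a j = isYes (ViewHolds? A (𝒱 j) a)

  classOf : (A : Structure σ) → Dom A → ℕ
  classOf A a = fromBits (viewType A a)

  classOf<2^N : (A : Structure σ) (a : Dom A) → classOf A a < 2 ^ N
  classOf<2^N A a = fromBits<2^N (viewType A a)

  InC-classOf : (A : Structure σ) (a : Dom A) → InC A 𝒱 (classOf A a) a
  InC-classOf A a j rewrite bit-fromBits (viewType A a) j with ViewHolds? A (𝒱 j) a
  ... | yes holds = holds
  ... | no fails  = fails

  InC⇒ViewEquivalent : {A B : Structure σ} {a : Dom A} {b : Dom B} (i : ℕ) →
                       InC A 𝒱 i a → InC B 𝒱 i b → ViewEquivalent A B a b
  InC⇒ViewEquivalent i a∈Cᵢ b∈Cᵢ j with bit i (toℕ j) | a∈Cᵢ j | b∈Cᵢ j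
  ... | true  | a⊨Vⱼ | b⊨Vⱼ = mk⇔ (λ _ → b⊨Vⱼ) (λ _ → a⊨Vⱼ)
  ... | false | a⊭Vⱼ | b⊭Vⱼ = mk⇔ (⊥-elim ∘′ a⊭Vⱼ) (⊥-elim ∘′ b⊭Vⱼ)

  ViewEquivalent-total : (A B : Structure σ) →
                         ((i : ℕ) → i < 2 ^ N → CNonEmpty A 𝒱 i → CNonEmpty B 𝒱 i) →
                         ∀ a → ∃ (ViewEquivalent A B a)
  ViewEquivalent-total A B C⊆ a =
    let i = classOf A a
        b , b∈Cᵢ = C⊆ i (classOf<2^N A a) (a , InC-classOf A a)
    in b , InC⇒ViewEquivalent {A} {B} i (InC-classOf A a) b∈Cᵢ

module _ {σ : Vocabulary} {N : ℕ} (𝒱 : Fin N → View σ) (A B : Structure σ) where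

  EnvRelated : Env A → Env B → Set
  EnvRelated e e′ = (x : ℕ) → Pointwise (ViewEquivalent 𝒱 A B) (e x) (e′ x)

  update-related : ∀ {e e′} x {a b} → ViewEquivalent 𝒱 A B a b → EnvRelated e e′ →
                   EnvRelated (update {A = A} e x a) (update {A = B} e′ x b)
  update-related x a≈b e≈e′ y with x ≡ᵇ y
  ... | true  = just a≈b
  ... | false = e≈e′ y

  Sat-invariant : (∀ a → ∃ (ViewEquivalent 𝒱 A B a)) →
                  (∀ b → ∃ λ a → ViewEquivalent 𝒱 A B a b) →
                  (φ : UCV N) {e : Env A} {e′ : Env B} → EnvRelated e e′ →
                  Sat A 𝒱 e φ ⇔ Sat B 𝒱 e′ φ
  Sat-invariant forth back (view j x) {e} {e′} e≈e′ with e x | e′ x | e≈e′ x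
  ... | just a  | just b  | just a≈b = a≈b j
  ... | nothing | nothing | nothing  = ⇔.refl
  Sat-invariant forth back (¬' φ) e≈e′ = ¬-cong-⇔ (Sat-invariant forth back φ e≈e′)
  Sat-invariant forth back (φ ∧' ψ) e≈e′ =
    Sat-invariant forth back φ e≈e′ ×-⇔ Sat-invariant forth back ψ e≈e′
  Sat-invariant forth back (∃' x φ) e≈e′ = mk⇔
    (λ (a , sat) → let b , a≈b = forth a in
      b , Equivalence.to (Sat-invariant forth back φ (update-related x a≈b e≈e′)) sat)
    (λ (b , sat) → let a , a≈b = back b in
      a , Equivalence.from (Sat-invariant forth back φ (update-related x a≈b e≈e′)) sat)

lemma4p7 : (σ : Vocabulary) (N : ℕ) (𝒱 : Fin N → View σ) (I J : Structure σ) →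
    ((i : ℕ) → i < 2 ^ N → (CNonEmpty I 𝒱 i ⇔ CNonEmpty J 𝒱 i)) →
    (φ : UCV N) → Sentence φ → ((I , 𝒱 ⊨ φ) ⇔ (J , 𝒱 ⊨ φ))
lemma4p7 σ N 𝒱 I J sameClasses φ _ = Sat-invariant 𝒱 I J forth back φ (λ _ → nothing)
  where
  forth : ∀ a → ∃ (ViewEquivalent 𝒱 I J a)
  forth = ViewEquivalent-total 𝒱 I J (λ i i<2^N → Equivalence.to (sameClasses i i<2^N))

  back : ∀ b → ∃ λ a → ViewEquivalent 𝒱 I J a b
  back b = let a , b≈a = ViewEquivalent-total 𝒱 J I
                           (λ i i<2^N → Equivalence.from (sameClasses i i<2^N)) b
           in a , λ j → ⇔.sym (b≈a j)
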